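{- Let $l\le k$ be nonnegative integers and let $\tau\in B_l$. Let $P=\tau\,k(k-1)\ldots(l+1)\in B_k$ and $Q=\bar{\tau}\,k(k-1)\ldots(l+1)\in B_k$. Then $|B_n(P)|=|B_n(Q)|$ and $|SI_n(P)|=|SI_n(Q)|$ for all $n\ge 1$.
   Context: $B_n$ is the set of signed permutations of $[n]$, written as words $\pi=\pi_1\cdots\pi_n$ in which each of $1,\dots,n$ appears exactly once, possibly barred (negative). $|\pi_i|$ is the unsigned value; $\bar{\pi}$ is obtained by changing the sign of every entry. A signed permutation $\pi\in B_n$ contains $\tau\in B_k$ if there are indices $i_1<\dots<i_k$ such that for all $a,b$: $|\pi_{i_a}|<|\pi_{i_b}|$ iff $|\tau_a|<|\tau_b|$, and $\pi_{i_a}$ is positive iff $\tau_a$ is positive; otherwise $\pi$ avoids $\tau$. $M(\tau)$ is the set of elements of $M$ avoiding $\tau$. $SI_n$ is the set of signed involutions in $B_n$ (signed permutations $\pi$, viewed as bijections of $\{\pm1,\dots,\pm n\}$ with $\pi(-i)=-\pi(i)$, satisfying $\pi\circ\pi=\mathrm{id}$). The word $\tau\,k(k-1)\ldots(l+1)$ is the concatenation of $\tau$ (on values $1,\dots,l$) with the unbarred letters $k,k-1,\dots,l+1$ in decreasing order. -}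

module Defs where

open import Data.Nat as ℕ using (ℕ; zero; suc; _∸_)
import Data.Nat.Properties as ℕP
open import Data.Integer as ℤ using (ℤ; +_; -[1+_]; ∣_∣; -_; 0ℤ)
import Data.Integer.Properties as ℤP
open import Data.List using (List; []; _∷_; _++_; map; length; filter; upTo; reverse; concatMap; zip)
open import Data.List.Relation.Unary.All using (All)
import Data.List.Relation.Unary.All as All
open import Data.List.Relation.Unary.Any using (Any)
import Data.List.Relation.Unary.Any as Any
open import Data.List.Relation.Unary.AllPairs using (AllPairs)
import Data.List.Relation.Unary.AllPairs as AllPairs
open import Data.List.Relation.Unary.Unique.Propositional using (Unique)
open import Data.Product using (_×_; _,_; proj₁; proj₂)
open import Function.Bundles using (_⇔_; mk⇔; Equivalence)
open import Relation.Nullary using (Dec; yes; no; ¬?; ¬_)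
open import Relation.Nullary.Decidable using (_×-dec_; _→-dec_)
open import Relation.Unary using (Decidable)
open import Relation.Binary.PropositionalEquality using (_≡_)

-- Signed words: a signed permutation is written as a word (list) of
-- nonzero integers; a barred letter ī is the negative integer -i.

SWord : Set
SWord = List ℤ

Pos : ℤ → Set
Pos x = 0ℤ ℤ.< x

pos? : (x : ℤ) → Dec (Pos x)
pos? x = 0ℤ ℤ.<? x

_⇔?_ : {P Q : Set} → Dec P → Dec Q → Dec (P ⇔ Q)
yes p ⇔? yes q = yes (mk⇔ (λ _ → q) (λ _ → p))
yes p ⇔? no ¬q = no (λ e → ¬q (Equivalence.to e p))
no ¬p ⇔? yes q = no (λ e → ¬p (Equivalence.from e q))
no ¬p ⇔? no ¬q = yes (mk⇔ (λ p → Relation.Nullary.contradiction p ¬p) (λ q → Relation.Nullary.contradiction q ¬q))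
  where import Relation.Nullary

InRange : ℕ → ℤ → Set
InRange n x = 1 ℕ.≤ ∣ x ∣ × ∣ x ∣ ℕ.≤ n

IsSignedPerm : ℕ → SWord → Set
IsSignedPerm n π = length π ≡ n × All (InRange n) π × Unique (map ∣_∣ π)

isSignedPerm? : (n : ℕ) → Decidable (IsSignedPerm n)
isSignedPerm? n π =
  (length π ℕ.≟ n) ×-dec
  (All.all? (λ x → (1 ℕ.≤? ∣ x ∣) ×-dec (∣ x ∣ ℕ.≤? n)) π ×-dec
  AllPairs.allPairs? (λ x y → ¬? (x ℕ.≟ y)) (map ∣_∣ π))

letters : ℕ → List ℤ
letters n = map (λ i → + suc i) (upTo n) ++ map (λ i → -[1+ i ]) (upTo n)

words : ℕ → List ℤ → List SWord
words zero    as = [] ∷ []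
words (suc m) as = concatMap (λ a → map (a ∷_) (words m as)) as

-- the finite set B_n, as a list (every signed permutation of [n]
-- occurs exactly once in it)
Bn : ℕ → List SWord
Bn n = filter (isSignedPerm? n) (words n (letters n))

subseqs : ℕ → List ℤ → List SWord
subseqs zero    xs       = [] ∷ []
subseqs (suc k) []       = []
subseqs (suc k) (x ∷ xs) = map (x ∷_) (subseqs k xs) ++ subseqs (suc k) xs

SameOrder : ℤ × ℤ → ℤ × ℤ → Set
SameOrder (s , t) (s' , t') = (∣ s ∣ ℕ.< ∣ s' ∣) ⇔ (∣ t ∣ ℕ.< ∣ t' ∣)

SameSign : ℤ × ℤ → Set
SameSign (s , t) = Pos s ⇔ Pos t

Isomorphic : SWord → SWord → Set
Isomorphic σ τ =
  length σ ≡ length τ ×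
  All (λ p → All (λ q → SameOrder p q) (zip σ τ)) (zip σ τ) ×
  All SameSign (zip σ τ)

isomorphic? : (σ τ : SWord) → Dec (Isomorphic σ τ)
isomorphic? σ τ =
  (length σ ℕ.≟ length τ) ×-dec
  (All.all? (λ p → All.all? (λ q → sameOrder? p q) (zip σ τ)) (zip σ τ) ×-dec
  All.all? (λ { (s , t) → pos? s ⇔? pos? t }) (zip σ τ))
  where
  sameOrder? : ∀ p q → Dec (SameOrder p q)
  sameOrder? (s , t) (s' , t') = (∣ s ∣ ℕ.<? ∣ s' ∣) ⇔? (∣ t ∣ ℕ.<? ∣ t' ∣)

Contains : SWord → SWord → Set
Contains π τ = Any (λ σ → Isomorphic σ τ) (subseqs (length τ) π)

Avoids : SWord → SWord → Set
Avoids π τ = ¬ Contains π τ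

avoids? : (τ π : SWord) → Dec (Avoids π τ)
avoids? τ π = ¬? (Any.any? (λ σ → isomorphic? σ τ) (subseqs (length τ) π))

-- π viewed as a map on {±1,…,±n}: π(i) = π_i, π(-i) = -π_i.
-- (entry at 1-based position i; only used for i in range)
at : SWord → ℕ → ℤ
at []       _             = 0ℤ
at (x ∷ xs) zero          = 0ℤ
at (x ∷ xs) (suc zero)    = x
at (x ∷ xs) (suc (suc i)) = at xs (suc i)

apply : SWord → ℤ → ℤ
apply π x with pos? x
... | yes _ = at π ∣ x ∣
... | no  _ = - at π ∣ x ∣

IsSignedInvolution : ℕ → SWord → Set
IsSignedInvolution n π = All (λ x → apply π (apply π x) ≡ x) (letters n)

isSignedInvolution? : (n : ℕ) → Decidable (IsSignedInvolution n)
isSignedInvolution? n π = All.all? (λ x → apply π (apply π x) ℤ.≟ x) (letters n)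

SIn : ℕ → List SWord
SIn n = filter (isSignedInvolution? n) (Bn n)

avoiding : SWord → List SWord → List SWord
avoiding τ M = filter (avoids? τ) M

decTail : ℕ → ℕ → SWord
decTail l k = reverse (map (λ i → + (l ℕ.+ suc i)) (upTo (k ∸ l)))

bar : SWord → SWord
bar τ = map -_ τ

-- Let m = k ∸ l and call a word of m positive letters with decreasing values a run.  The
-- map toggle bars or unbars each letter π_i whose suffix after position i contains a run
-- all of whose letters exceed |π_i|.  Toggling never changes which suffixes contain a run
-- above a given bound (a run letter that gets toggled is itself followed by a run above
-- it), so toggle is an involution preserving absolute values.  In an occurrence of
-- τ k(k-1)…(l+1) every letter of the τ-part is followed by the tail, a run lying above
-- it, so toggle flips exactly the τ-part and keeps a run after it: the result contains
-- τ̄ k(k-1)…(l+1).  Hence toggle exchanges the avoiders of P and of Q.  For a signed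
-- involution, transposing the diagram exchanges the runs after position i above |π_i|
-- with the runs after position |π_i| above i, so positions i and |π_i| are toggled
-- together and toggle preserves SI_n.

module Submission where

open import Defs
open import Data.Bool using (Bool; true; false)
open import Data.Empty using (⊥; ⊥-elim)
open import Data.Integer as ℤ using (ℤ; +_; -[1+_]; ∣_∣; -_; 0ℤ)
import Data.Integer.Properties as ℤ
open import Data.List using (List; []; _∷_; _++_; length; map; zip; reverse; drop; upTo)
import Data.List.Properties as List
open import Data.List.Extrema.Nat using (max; xs≤max; max<v⁺)
open import Data.List.Membership.Propositional using (_∈_; lose; find)
open import Data.List.Membership.Propositional.Properties
open import Data.List.Membership.Propositional.Properties.WithK using (unique∧set⇒bag)
open import Data.List.Relation.Binary.BagAndSetEquality using (_∼[_]_; set; ∼bag⇒↭)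
open import Data.List.Relation.Binary.Permutation.Propositional.Properties using (↭-length)
open import Data.List.Relation.Binary.Sublist.Propositional
  using (_⊆_; []; _∷_; _∷ʳ_; minimum; ⊆-refl; ⊆-trans; lookup)
import Data.List.Relation.Binary.Sublist.Propositional.Properties as Sublist
open import Data.List.Relation.Unary.All as All using (All; []; _∷_)
import Data.List.Relation.Unary.All.Properties as All
open import Data.List.Relation.Unary.AllPairs as AllPairs using (AllPairs; []; _∷_)
import Data.List.Relation.Unary.AllPairs.Properties as AllPairs
open import Data.List.Relation.Unary.Any using (Any; here; there; any?)
import Data.List.Relation.Unary.Any.Properties as Any
open import Data.List.Relation.Unary.Unique.Propositional using (Unique)
import Data.List.Relation.Unary.Unique.Propositional.Properties as Unique
open import Data.Nat as ℕ using (ℕ; zero; suc; _≤_; _<_; z≤n; s≤s; _∸_)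
import Data.Nat.Properties as ℕ
open import Data.Product as Product using (_×_; _,_; proj₁; proj₂; ∃-syntax; uncurry)
open import Data.Sum as Sum using (_⊎_; inj₁; inj₂; [_,_])
open import Function using (id; _∘_; flip; _on_)
open import Function.Bundles using (_⇔_; mk⇔; Equivalence)
open import Level using (Level)
open import Relation.Binary using (Rel; Irreflexive; Transitive; _Respects_)
open import Relation.Binary.PropositionalEquality hiding ([_])
open import Relation.Nullary using (¬_; Dec; yes; no; does)
open import Relation.Nullary.Decidable using (dec-true; dec-false; map′; _×-dec_)

private
  variable
    a ℓ : Level
    A B : Set a
    xs ys : List A

zip-++ : ∀ {xs zs : List A} {ys ws : List B} → length xs ≡ length ys →
         zip (xs ++ zs) (ys ++ ws) ≡ zip xs ys ++ zip zs ws
zip-++ {xs = []}     {ys = []}     _  = refl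
zip-++ {xs = x ∷ xs} {zs} {y ∷ ys} {ws} eq =
  cong ((x , y) ∷_) (zip-++ {xs = xs} {zs} {ys} {ws} (ℕ.suc-injective eq))

All-zip : ∀ {P : A → Set ℓ} {Q : B → Set ℓ} {xs ys} → All P xs → All Q ys →
          All (λ z → P (proj₁ z) × Q (proj₂ z)) (zip xs ys)
All-zip []       _        = []
All-zip (_ ∷ _)  []       = []
All-zip (p ∷ ps) (q ∷ qs) = (p , q) ∷ All-zip ps qs

All-unzip : ∀ {P : A → Set ℓ} {Q : B → Set ℓ} {xs ys} → length xs ≡ length ys →
            All (λ z → Q (proj₂ z) → P (proj₁ z)) (zip xs ys) → All Q ys → All P xs
All-unzip {xs = []}    {[]}    _  _        _        = []
All-unzip {xs = _ ∷ _} {_ ∷ _} eq (f ∷ fs) (q ∷ qs) = f q ∷ All-unzip (ℕ.suc-injective eq) fs qs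

All-swap : ∀ {R : A → B → Set ℓ} {xs ys} →
           All (λ x → All (R x) ys) xs → All (λ y → All (λ x → R x y) xs) ys
All-swap {ys = []}    _   = []
All-swap {ys = _ ∷ _} rss = All.map All.head rss ∷ All-swap (All.map All.tail rss)

All-reverse : ∀ {P : A → Set ℓ} {xs} → All P xs → All P (reverse xs)
All-reverse ps = All.tabulate (All.lookup ps ∘ Any.reverse⁻)

AllPairs-reverse : ∀ {R : Rel A ℓ} {xs} → AllPairs R xs → AllPairs (flip R) (reverse xs)
AllPairs-reverse [] = []
AllPairs-reverse {xs = x ∷ xs} (r ∷ rs) rewrite List.unfold-reverse x xs =
  AllPairs.++⁺ (AllPairs-reverse rs) ([] ∷ []) (All.map (_∷ []) (All-reverse r))

AllPairs-resp-⊆ : ∀ {R : Rel A ℓ} → (AllPairs R) Respects (flip _⊆_)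
AllPairs-resp-⊆ []        []       = []
AllPairs-resp-⊆ (_ ∷ʳ p)  (_ ∷ rs) = AllPairs-resp-⊆ p rs
AllPairs-resp-⊆ (refl ∷ p) (r ∷ rs) = All.tabulate (All.lookup r ∘ lookup p) ∷ AllPairs-resp-⊆ p rs

⊆-map⁻ : ∀ (f : A → B) {ws} ys → ws ⊆ map f ys → ∃[ zs ] zs ⊆ ys × map f zs ≡ ws
⊆-map⁻ f []       []         = [] , [] , refl
⊆-map⁻ f (y ∷ ys) (_ ∷ʳ p)   with zs , q , eq ← ⊆-map⁻ f ys p = zs , y ∷ʳ q , eq
⊆-map⁻ f (y ∷ ys) (refl ∷ p) with zs , q , eq ← ⊆-map⁻ f ys p = y ∷ zs , refl ∷ q , cong (f y ∷_) eq

module _ {_≺_ : Rel A ℓ} (≺-irrefl : Irreflexive _≡_ _≺_) (≺-trans : Transitive _≺_) where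

  private
    ∈-tail : ∀ {x z xs} → x ≺ z → z ∈ x ∷ xs → z ∈ xs
    ∈-tail x≺z (here refl) = ⊥-elim (≺-irrefl refl x≺z)
    ∈-tail _   (there z∈)  = z∈

  sorted-⊆ : AllPairs _≺_ xs → AllPairs _≺_ ys → All (_∈ xs) ys → ys ⊆ xs
  sorted-⊆ {xs = xs} _ [] [] = minimum xs
  sorted-⊆ (_ ∷ sxs) (y≺ys ∷ sys) (here refl ∷ ys∈) =
    refl ∷ sorted-⊆ sxs sys (All.zipWith (λ (y≺z , z∈) → ∈-tail y≺z z∈) (y≺ys , ys∈))
  sorted-⊆ {xs = x ∷ _} {ys = y ∷ _} (x≺xs ∷ sxs) (y≺ys ∷ sys) (there y∈ ∷ ys∈) =
    x ∷ʳ sorted-⊆ sxs (y≺ys ∷ sys)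
      (y∈ ∷ All.zipWith (λ (y≺z , z∈) → ∈-tail (≺-trans x≺y y≺z) z∈) (y≺ys , ys∈))
    where
    x≺y : x ≺ y
    x≺y = All.lookup x≺xs y∈

++-⊆-split : ∀ (σ₁ : List A) {σ₂ π} → σ₁ ++ σ₂ ⊆ π →
             ∃[ α ] ∃[ β ] π ≡ α ++ β × σ₁ ⊆ α × σ₂ ⊆ β
++-⊆-split []       {π = π} p = [] , π , refl , [] , p
++-⊆-split (x ∷ σ₁) (y ∷ʳ p) with α , β , refl , p₁ , p₂ ← ++-⊆-split (x ∷ σ₁) p =
  y ∷ α , β , refl , y ∷ʳ p₁ , p₂
++-⊆-split (x ∷ σ₁) (refl ∷ p) with α , β , refl , p₁ , p₂ ← ++-⊆-split σ₁ p =
  x ∷ α , β , refl , refl ∷ p₁ , p₂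

++-length-split : ∀ (σ : List A) {τ δ : List B} → length σ ≡ length (τ ++ δ) →
                  ∃[ σ₁ ] ∃[ σ₂ ] σ ≡ σ₁ ++ σ₂ × length σ₁ ≡ length τ
++-length-split σ       {[]}    _ = [] , σ , refl , refl
++-length-split (s ∷ σ) {_ ∷ τ} e
  with σ₁ , σ₂ , refl , len ← ++-length-split σ {τ} (ℕ.suc-injective e) = s ∷ σ₁ , σ₂ , refl , cong suc len

involution⇒length-≡ : ∀ {xs ys : List A} (f : A → A) → (∀ x → f (f x) ≡ x) → Unique xs → Unique ys →
                      (∀ {x} → x ∈ xs → f x ∈ ys) → (∀ {y} → y ∈ ys → f y ∈ xs) →
                      length xs ≡ length ys
involution⇒length-≡ {xs = xs} {ys} f f-inv xs-unique ys-unique f[xs]⊆ys f[ys]⊆xs =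
  trans (sym (List.length-map f xs)) (↭-length (∼bag⇒↭ (unique∧set⇒bag f[xs]-unique ys-unique f[xs]≈ys)))
  where
  f[xs]-unique : Unique (map f xs)
  f[xs]-unique = Unique.map⁺ (λ {a} {b} fa≡fb → trans (sym (f-inv a)) (trans (cong f fa≡fb) (f-inv b))) xs-unique
  f[xs]≈ys : map f xs ∼[ set ] ys
  f[xs]≈ys {z} = mk⇔
    (λ z∈ → let x , x∈ , z≡fx = ∈-map⁻ f z∈ in subst (_∈ ys) (sym z≡fx) (f[xs]⊆ys x∈))
    (λ z∈ → subst (_∈ map f xs) (f-inv z) (∈-map⁺ f (f[ys]⊆xs z∈)))

-- Occurrences of patterns

subseqs⁺ : ∀ {σ π : SWord} → σ ⊆ π → σ ∈ subseqs (length σ) π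
subseqs⁺ []                         = here refl
subseqs⁺ {σ = []}          (_ ∷ʳ _) = here refl
subseqs⁺ {σ = _ ∷ σ} {y ∷ π} (_ ∷ʳ p) = ∈-++⁺ʳ (map (y ∷_) (subseqs (length σ) π)) (subseqs⁺ p)
subseqs⁺ (refl ∷ p)                 = ∈-++⁺ˡ (∈-map⁺ _ (subseqs⁺ p))

subseqs⁻ : ∀ k (π : SWord) {σ} → σ ∈ subseqs k π → σ ⊆ π × length σ ≡ k
subseqs⁻ zero    π       (here refl) = minimum π , refl
subseqs⁻ (suc k) (x ∷ π) σ∈ with ∈-++⁻ (map (x ∷_) (subseqs k π)) σ∈
... | inj₁ σ∈ˡ with _ , σ∈′ , refl ← ∈-map⁻ (x ∷_) σ∈ˡ =
  Product.map (refl ∷_) (cong suc) (subseqs⁻ k π σ∈′)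
... | inj₂ σ∈ʳ = Product.map₁ (x ∷ʳ_) (subseqs⁻ (suc k) π σ∈ʳ)

contains⁺ : ∀ {σ π ρ} → σ ⊆ π → Isomorphic σ ρ → Contains π ρ
contains⁺ {σ} {π} σ⊆π iso@(len , _) = lose (subst (λ k → σ ∈ subseqs k π) len (subseqs⁺ σ⊆π)) iso

contains⁻ : ∀ {π ρ} → Contains π ρ → ∃[ σ ] σ ⊆ π × Isomorphic σ ρ
contains⁻ {π} {ρ} c with σ , σ∈ , iso ← find c = σ , proj₁ (subseqs⁻ (length ρ) π σ∈) , iso

private
  both : ∀ {P Q : Set} → P → Q → P ⇔ Q
  both p q = mk⇔ (λ _ → q) (λ _ → p)

  neither : ∀ {P Q : Set} → ¬ P → ¬ Q → P ⇔ Q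
  neither ¬p ¬q = mk⇔ (⊥-elim ∘ ¬p) (⊥-elim ∘ ¬q)

Decreasing : SWord → Set
Decreasing ws = All Pos ws × AllPairs (λ a b → ∣ b ∣ < ∣ a ∣) ws

Above : ℕ → SWord → Set
Above t ws = All (λ w → t < ∣ w ∣) ws

RunAbove : ℕ → ℕ → SWord → Set
RunAbove m t ws = length ws ≡ m × Decreasing ws × Above t ws

OrderIso : List (ℤ × ℤ) → Set
OrderIso Z = All (λ p → All (SameOrder p) Z) Z

Below : SWord → SWord → Set
Below σ ρ = All (λ s → All (λ r → ∣ s ∣ < ∣ r ∣) ρ) σ

≤-below : ∀ {M σ ρ} → All (λ s → ∣ s ∣ ≤ M) σ → Above M ρ → Below σ ρ
≤-below σ≤M M<ρ = All.map (λ s≤M → All.map (ℕ.≤-<-trans s≤M) M<ρ) σ≤M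

iso-++⁺ : ∀ {σ₁ σ₂ τ₁ τ₂} → Isomorphic σ₁ τ₁ → Isomorphic σ₂ τ₂ → Below σ₁ σ₂ → Below τ₁ τ₂ →
          Isomorphic (σ₁ ++ σ₂) (τ₁ ++ τ₂)
iso-++⁺ {σ₁} {σ₂} {τ₁} {τ₂} (e₁ , o₁ , s₁) (e₂ , o₂ , s₂) σ₁<σ₂ τ₁<τ₂ =
  length-eq ,
  subst OrderIso (sym zip-eq)
    (All.++⁺ (All.zipWith (uncurry All.++⁺) (o₁ , cross₁₂))
             (All.zipWith (uncurry All.++⁺) (cross₂₁ , o₂))) ,
  subst (All SameSign) (sym zip-eq) (All.++⁺ s₁ s₂)
  where
  zip-eq : zip (σ₁ ++ σ₂) (τ₁ ++ τ₂) ≡ zip σ₁ τ₁ ++ zip σ₂ τ₂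
  zip-eq = zip-++ {xs = σ₁} {σ₂} {τ₁} {τ₂} e₁
  length-eq : length (σ₁ ++ σ₂) ≡ length (τ₁ ++ τ₂)
  length-eq = begin
    length (σ₁ ++ σ₂)         ≡⟨ List.length-++ σ₁ ⟩
    length σ₁ ℕ.+ length σ₂   ≡⟨ cong₂ ℕ._+_ e₁ e₂ ⟩
    length τ₁ ℕ.+ length τ₂   ≡⟨ List.length-++ τ₁ ⟨
    length (τ₁ ++ τ₂)         ∎
    where open ≡-Reasoning
  below : All (λ p → All (λ q → ∣ proj₁ p ∣ < ∣ proj₁ q ∣ × ∣ proj₂ p ∣ < ∣ proj₂ q ∣) (zip σ₂ τ₂))
              (zip σ₁ τ₁)
  below = All.map (uncurry All-zip) (All-zip σ₁<σ₂ τ₁<τ₂)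
  cross₁₂ : All (λ p → All (SameOrder p) (zip σ₂ τ₂)) (zip σ₁ τ₁)
  cross₁₂ = All.map (All.map (uncurry both)) below
  cross₂₁ : All (λ q → All (SameOrder q) (zip σ₁ τ₁)) (zip σ₂ τ₂)
  cross₂₁ = All-swap (All.map (All.map (λ (s< , t<) → neither (ℕ.<-asym s<) (ℕ.<-asym t<))) below)

iso-++⁻ : ∀ {σ₁ σ₂ τ₁ τ₂} → length σ₁ ≡ length τ₁ → Below τ₁ τ₂ → Isomorphic (σ₁ ++ σ₂) (τ₁ ++ τ₂) →
          Isomorphic σ₁ τ₁ × Isomorphic σ₂ τ₂ × Below σ₁ σ₂
iso-++⁻ {σ₁} {σ₂} {τ₁} {τ₂} e₁ τ₁<τ₂ (e , o , s)
  with o₁ , o₂ ← All.++⁻ (zip σ₁ τ₁) (subst OrderIso (zip-++ {xs = σ₁} {σ₂} {τ₁} {τ₂} e₁) o)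
  with s₁ , s₂ ← All.++⁻ (zip σ₁ τ₁) (subst (All SameSign) (zip-++ {xs = σ₁} {σ₂} {τ₁} {τ₂} e₁) s) =
  (e₁ , All.map (All.++⁻ˡ Z₁) o₁ , s₁) , (e₂ , All.map (All.++⁻ʳ Z₁) o₂ , s₂) , σ₁<σ₂
  where
  Z₁ : List (ℤ × ℤ)
  Z₁ = zip σ₁ τ₁
  e₂ : length σ₂ ≡ length τ₂
  e₂ = ℕ.+-cancelˡ-≡ (length σ₁) _ _ (begin
    length σ₁ ℕ.+ length σ₂   ≡⟨ List.length-++ σ₁ ⟨
    length (σ₁ ++ σ₂)         ≡⟨ e ⟩
    length (τ₁ ++ τ₂)         ≡⟨ List.length-++ τ₁ ⟩
    length τ₁ ℕ.+ length τ₂   ≡⟨ cong (ℕ._+ length τ₂) e₁ ⟨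
    length σ₁ ℕ.+ length τ₂   ∎)
    where open ≡-Reasoning
  σ₁<σ₂ : Below σ₁ σ₂
  σ₁<σ₂ = All-unzip e₁ (All.map (λ os → All-unzip e₂ (All.map Equivalence.from (All.++⁻ʳ Z₁ os))) o₁) τ₁<τ₂

pos-neg : ∀ x → 0 < ∣ x ∣ → Pos (- x) ⇔ (¬ Pos x)
pos-neg (+ suc n)  _ = mk⇔ (λ ()) (λ ¬p → ⊥-elim (¬p (ℤ.+<+ ℕ.z<s)))
pos-neg -[1+ n ]   _ = mk⇔ (λ _ ()) (λ _ → ℤ.+<+ ℕ.z<s)

sameSign-neg : ∀ {s t} → 0 < ∣ s ∣ → 0 < ∣ t ∣ → SameSign (s , t) → SameSign (- s , - t)
sameSign-neg {s} {t} s≢0 t≢0 s~t = mk⇔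
  (λ p-s → from t⇔ (λ pt → to s⇔ p-s (from s~t pt)))
  (λ p-t → from s⇔ (λ ps → to t⇔ p-t (to s~t ps)))
  where
  open Equivalence
  s⇔ = pos-neg s s≢0
  t⇔ = pos-neg t t≢0

sameOrder-neg : ∀ p q → SameOrder p q → SameOrder (Product.map -_ -_ p) (Product.map -_ -_ q)
sameOrder-neg (s , t) (s′ , t′)
  rewrite ℤ.∣-i∣≡∣i∣ s | ℤ.∣-i∣≡∣i∣ t | ℤ.∣-i∣≡∣i∣ s′ | ℤ.∣-i∣≡∣i∣ t′ = id

∣bar∣ : ∀ σ → map ∣_∣ (bar σ) ≡ map ∣_∣ σ
∣bar∣ σ = trans (sym (List.map-∘ σ)) (List.map-cong ℤ.∣-i∣≡∣i∣ σ)

All-bar : ∀ {P : ℕ → Set} {σ} → All (P ∘ ∣_∣) σ → All (P ∘ ∣_∣) (bar σ)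
All-bar {P = P} {σ} ps = All.map⁻ (subst (All P) (sym (∣bar∣ σ)) (All.map⁺ ps))

bar-involutive : ∀ σ → bar (bar σ) ≡ σ
bar-involutive σ = trans (sym (List.map-∘ σ)) (trans (List.map-cong ℤ.neg-involutive σ) (List.map-id σ))

iso-bar : ∀ {σ τ} → All (λ s → 0 < ∣ s ∣) σ → All (λ t → 0 < ∣ t ∣) τ →
          Isomorphic σ τ → Isomorphic (bar σ) (bar τ)
iso-bar {σ} {τ} σ≢0 τ≢0 (e , o , s) =
  trans (List.length-map -_ σ) (trans e (sym (List.length-map -_ τ))) ,
  subst OrderIso (sym zip-eq)
    (All.map⁺ (All.map (λ {p} os → All.map⁺ (All.map (λ {q} → sameOrder-neg p q) os)) o)) ,
  subst (All SameSign) (sym zip-eq)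
    (All.map⁺ (All.zipWith (λ ((s≢0 , t≢0) , s~t) → sameSign-neg s≢0 t≢0 s~t) (All-zip σ≢0 τ≢0 , s)))
  where
  zip-eq : zip (bar σ) (bar τ) ≡ map (Product.map -_ -_) (zip σ τ)
  zip-eq = List.zip-map -_ -_ σ τ

pos⇒∣∣>0 : ∀ {x} → Pos x → 0 < ∣ x ∣
pos⇒∣∣>0 (ℤ.+<+ 0<n) = 0<n

decreasing-iso : ∀ {σ ρ} → length σ ≡ length ρ → Decreasing σ → Decreasing ρ → Isomorphic σ ρ
decreasing-iso {[]}    {[]}    _ _ _ = refl , [] , []
decreasing-iso {s ∷ σ} {r ∷ ρ} e (ps ∷ pσ , s> ∷ dσ) (pr ∷ pρ , r> ∷ dρ)
  with _ , o , ss ← decreasing-iso (ℕ.suc-injective e) (pσ , dσ) (pρ , dρ) =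
  e , row ∷ rows , both ps pr ∷ ss
  where
  below : All (λ q → ∣ proj₁ q ∣ < ∣ s ∣ × ∣ proj₂ q ∣ < ∣ r ∣) (zip σ ρ)
  below = All-zip s> r>
  row : All (SameOrder (s , r)) ((s , r) ∷ zip σ ρ)
  row = neither (ℕ.<-irrefl refl) (ℕ.<-irrefl refl) ∷
        All.map (λ (a , b) → neither (ℕ.<-asym a) (ℕ.<-asym b)) below
  rows : All (λ q → All (SameOrder q) ((s , r) ∷ zip σ ρ)) (zip σ ρ)
  rows = All.zipWith (λ ((a , b) , os) → both a b ∷ os) (below , o)

iso-decreasing : ∀ {σ ρ} → Isomorphic σ ρ → Decreasing ρ → Decreasing σ
iso-decreasing {[]}    {[]}    _ _ = [] , []
iso-decreasing {s ∷ σ} {r ∷ ρ} (e , (_ ∷ _) ∷ rows , s~r ∷ ss) (pr ∷ pρ , r> ∷ dρ)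
  with pσ , dσ ← iso-decreasing (ℕ.suc-injective e , All.map All.tail rows , ss) (pρ , dρ) =
  Equivalence.from s~r pr ∷ pσ ,
  All-unzip (ℕ.suc-injective e) (All.map (Equivalence.from ∘ All.head) rows) r> ∷ dσ

decTail-runAbove : ∀ l k → RunAbove (k ∸ l) l (decTail l k)
decTail-runAbove l k = decTail-length , decTail-decreasing , decTail-above
  where
  g : ℕ → ℤ
  g i = + (l ℕ.+ suc i)
  decTail-length : length (decTail l k) ≡ k ∸ l
  decTail-length = begin
    length (decTail l k)          ≡⟨ List.length-reverse (map g (upTo (k ∸ l))) ⟩
    length (map g (upTo (k ∸ l))) ≡⟨ List.length-map g (upTo (k ∸ l)) ⟩
    length (upTo (k ∸ l))         ≡⟨ List.length-upTo (k ∸ l) ⟩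
    k ∸ l                         ∎
    where open ≡-Reasoning
  decTail-decreasing : Decreasing (decTail l k)
  decTail-decreasing =
    All-reverse (All.map⁺ (All.applyUpTo⁺₂ _ (k ∸ l)
                             (λ i → ℤ.+<+ (ℕ.<-≤-trans ℕ.z<s (ℕ.m≤n+m (suc i) l))))) ,
    AllPairs-reverse (AllPairs.map⁺ (AllPairs.applyUpTo⁺₁ _ (k ∸ l) (λ i<j _ → ℕ.+-monoʳ-< l (ℕ.s<s i<j))))
  decTail-above : Above l (decTail l k)
  decTail-above = All-reverse (All.map⁺ (All.applyUpTo⁺₂ _ (k ∸ l) (λ _ → ℕ.m<m+n l ℕ.z<s)))

-- Enumerating B_n and SI_n

letters-complete : ∀ {n} x → InRange n x → x ∈ letters n
letters-complete {n} (+ suc i) (_ , i<n) = ∈-++⁺ˡ (∈-map⁺ (λ i → + suc i) (∈-upTo⁺ i<n))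
letters-complete {n} -[1+ i ]  (_ , i<n) =
  ∈-++⁺ʳ (map (λ i → + suc i) (upTo n)) (∈-map⁺ -[1+_] (∈-upTo⁺ i<n))

letters-sound : ∀ {n x} → x ∈ letters n → InRange n x
letters-sound {n} x∈ with ∈-++⁻ (map (λ i → + suc i) (upTo n)) x∈
... | inj₁ x∈⁺ with _ , i∈ , refl ← ∈-map⁻ (λ i → + suc i) x∈⁺ = s≤s z≤n , ∈-upTo⁻ i∈
... | inj₂ x∈⁻ with _ , i∈ , refl ← ∈-map⁻ -[1+_] x∈⁻ = s≤s z≤n , ∈-upTo⁻ i∈

letters-unique : ∀ n → Unique (letters n)
letters-unique n =
  Unique.++⁺ (Unique.map⁺ (λ { refl → refl }) (Unique.upTo⁺ n))
             (Unique.map⁺ (λ { refl → refl }) (Unique.upTo⁺ n))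
             (λ (x∈⁺ , x∈⁻) → disjoint x∈⁺ x∈⁻)
  where
  disjoint : ∀ {x} → x ∈ map (λ i → + suc i) (upTo n) → x ∈ map -[1+_] (upTo n) → ⊥
  disjoint x∈⁺ x∈⁻ with _ , _ , refl ← ∈-map⁻ (λ i → + suc i) x∈⁺
                   with _ , _ , () ← ∈-map⁻ -[1+_] x∈⁻

words-complete : ∀ k (L : List ℤ) π → length π ≡ k → All (_∈ L) π → π ∈ words k L
words-complete zero    L []      _   []         = here refl
words-complete (suc k) L (x ∷ π) len (x∈ ∷ π⊆) =
  ∈-concatMap⁺ (λ a → map (a ∷_) (words k L))
    (lose x∈ (∈-map⁺ (x ∷_) (words-complete k L π (ℕ.suc-injective len) π⊆)))

words-unique : ∀ k (L : List ℤ) → Unique L → Unique (words k L)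
words-unique zero    L _        = [] ∷ []
words-unique (suc k) L L-unique =
  Unique.concat⁺
    (All.map⁺ (All.tabulate (λ _ → Unique.map⁺ (proj₂ ∘ List.∷-injective) (words-unique k L L-unique))))
    (AllPairs.map⁺ (AllPairs.map (λ a≢b {_} (v∈a , v∈b) → a≢b (same-head v∈a v∈b)) L-unique))
  where
  same-head : ∀ {a b v} → v ∈ map (a ∷_) (words k L) → v ∈ map (b ∷_) (words k L) → a ≡ b
  same-head v∈a v∈b with _ , _ , refl ← ∈-map⁻ _ v∈a with _ , _ , eq ← ∈-map⁻ _ v∈b =
    proj₁ (List.∷-injective eq)

Bn-unique : ∀ n → Unique (Bn n)
Bn-unique n = Unique.filter⁺ (isSignedPerm? n) (words-unique n (letters n) (letters-unique n))

∈-Bn⁺ : ∀ {n π} → IsSignedPerm n π → π ∈ Bn n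
∈-Bn⁺ {n} {π} perm@(len , π-range , _) =
  ∈-filter⁺ (isSignedPerm? n) (words-complete n (letters n) π len (All.map (letters-complete _) π-range)) perm

∈-Bn⁻ : ∀ n {π} → π ∈ Bn n → IsSignedPerm n π
∈-Bn⁻ n π∈ = proj₂ (∈-filter⁻ (isSignedPerm? n) {xs = words n (letters n)} π∈)

signedPerm-nonzero : ∀ {n π} → IsSignedPerm n π → All (λ x → 0 < ∣ x ∣) π
signedPerm-nonzero (_ , π-range , _) = All.map proj₁ π-range

SIn-unique : ∀ n → Unique (SIn n)
SIn-unique n = Unique.filter⁺ (isSignedInvolution? n) (Bn-unique n)

∈-SIn⁻ : ∀ n {π} → π ∈ SIn n → IsSignedPerm n π × IsSignedInvolution n π
∈-SIn⁻ n π∈ = Product.map₁ (∈-Bn⁻ n) (∈-filter⁻ (isSignedInvolution? n) {xs = Bn n} π∈)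

-- Diagrams of words

-- Positions are counted from 1, as in at.
points : SWord → List (ℕ × ℤ)
points []       = []
points (x ∷ xs) = (1 , x) ∷ map (Product.map₁ suc) (points xs)

points-values : ∀ π → map proj₂ (points π) ≡ π
points-values []       = refl
points-values (x ∷ xs) = cong (x ∷_) (trans (sym (List.map-∘ (points xs))) (points-values xs))

∈-points⁻ : ∀ {π p x} → (p , x) ∈ points π → 1 ≤ p × p ≤ length π × at π p ≡ x
∈-points⁻ {_ ∷ _}  (here refl) = s≤s z≤n , s≤s z≤n , refl
∈-points⁻ {_ ∷ xs} (there d∈) with _ , d∈′ , refl ← ∈-map⁻ (Product.map₁ suc) d∈
                               with s≤s _ , q≤ , at≡ ← ∈-points⁻ {xs} d∈′ = s≤s z≤n , s≤s q≤ , at≡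

∈-points⁺ : ∀ {π p x} → at π p ≡ x → 0 < ∣ x ∣ → (p , x) ∈ points π
∈-points⁺ {[]}    refl ()
∈-points⁺ {_ ∷ _} {zero}        refl ()
∈-points⁺ {_ ∷ _} {suc zero}    refl _   = here refl
∈-points⁺ {_ ∷ xs} {suc (suc q)} at≡ x≢0 =
  there (∈-map⁺ (Product.map₁ suc) (∈-points⁺ {xs} {suc q} at≡ x≢0))

points-sorted : ∀ π → AllPairs (_<_ on proj₁) (points π)
points-sorted []       = []
points-sorted (x ∷ xs) =
  All.map⁺ (All.tabulate (λ d∈ → s≤s (proj₁ (∈-points⁻ d∈)))) ∷
  AllPairs.map⁺ (AllPairs.map s≤s (points-sorted xs))

drop-points : ∀ i π → drop i π ≡ map proj₂ (drop i (points π))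
drop-points i π = trans (cong (drop i) (sym (points-values π))) (List.drop-map i (points π))

∈-drop-points⁻ : ∀ i π {d} → d ∈ drop i (points π) → d ∈ points π × i < proj₁ d
∈-drop-points⁻ zero    π        d∈ = d∈ , proj₁ (∈-points⁻ d∈)
∈-drop-points⁻ (suc i) (x ∷ xs) d∈
  with d′ , d′∈ , refl ← ∈-map⁻ (Product.map₁ suc) (subst (_ ∈_) (List.drop-map i (points xs)) d∈)
  with d′∈xs , i<d′ ← ∈-drop-points⁻ i xs d′∈ = there (∈-map⁺ _ d′∈xs) , s≤s i<d′

∈-drop-points⁺ : ∀ i π {d} → d ∈ points π → i < proj₁ d → d ∈ drop i (points π)
∈-drop-points⁺ zero    π        d∈          _   = d∈
∈-drop-points⁺ (suc i) (x ∷ xs) (here refl) (s≤s ())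
∈-drop-points⁺ (suc i) (x ∷ xs) (there d∈) i<d with d′ , d′∈ , refl ← ∈-map⁻ (Product.map₁ suc) d∈ =
  subst (_ ∈_) (sym (List.drop-map i (points xs))) (∈-map⁺ _ (∈-drop-points⁺ i xs d′∈ (ℕ.≤-pred i<d)))

pos⇒≡+∣∣ : ∀ {x} → Pos x → x ≡ + ∣ x ∣
pos⇒≡+∣∣ (ℤ.+<+ _) = refl

PointRun : SWord → ℕ → ℕ → List (ℕ × ℤ) → Set
PointRun π i t D =
  All (λ d → d ∈ points π × i < proj₁ d × Pos (proj₂ d) × t < ∣ proj₂ d ∣) D ×
  AllPairs (λ d e → proj₁ d < proj₁ e × ∣ proj₂ e ∣ < ∣ proj₂ d ∣) D

DiagonallySymmetric : SWord → Set
DiagonallySymmetric π = ∀ {p v} → (p , + v) ∈ points π → 0 < v → (v , + p) ∈ points π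

transpose : ℕ × ℤ → ℕ × ℤ
transpose (p , x) = ∣ x ∣ , + p

pointRun-transpose : ∀ {π i t D} → DiagonallySymmetric π → PointRun π i t D →
                     PointRun π t i (reverse (map transpose D))
pointRun-transpose {π} sym-π (ps , sorted) =
  All-reverse (All.map⁺ (All.map transpose-point ps)) ,
  AllPairs-reverse (AllPairs.map⁺ (AllPairs.map Product.swap sorted))
  where
  transpose-point : ∀ {i t d} → d ∈ points π × i < proj₁ d × Pos (proj₂ d) × t < ∣ proj₂ d ∣ →
                    transpose d ∈ points π × t < ∣ proj₂ d ∣ × Pos (+ proj₁ d) × i < proj₁ d
  transpose-point (d∈ , i<p , pos , t<x) =
    sym-π (subst (λ x → (_ , x) ∈ points π) (pos⇒≡+∣∣ pos) d∈) (pos⇒∣∣>0 pos) ,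
    t<x , ℤ.+<+ (ℕ.≤-<-trans z≤n i<p) , i<p

negIf : Bool → ℤ → ℤ
negIf true  x = - x
negIf false x = x

∣negIf∣ : ∀ b x → ∣ negIf b x ∣ ≡ ∣ x ∣
∣negIf∣ true  x = ℤ.∣-i∣≡∣i∣ x
∣negIf∣ false x = refl

negIf-0 : ∀ b → negIf b 0ℤ ≡ 0ℤ
negIf-0 true  = refl
negIf-0 false = refl

neg-negIf : ∀ b x → - negIf b x ≡ negIf b (- x)
neg-negIf true  x = refl
neg-negIf false x = refl

negIf-involutive : ∀ b x → negIf b (negIf b x) ≡ x
negIf-involutive true  x = ℤ.neg-involutive x
negIf-involutive false x = refl

All-at : ∀ {P : ℤ → Set} {π i} → All P π → 1 ≤ i → i ≤ length π → P (at π i)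
All-at {i = suc zero}    (p ∷ _)  _ _          = p
All-at {i = suc (suc i)} (_ ∷ ps) _ (s≤s i≤n) = All-at {i = suc i} ps (s≤s z≤n) i≤n

at-nonzero : ∀ {n π i} → IsSignedPerm n π → 1 ≤ i → i ≤ n → 0 < ∣ at π i ∣
at-nonzero perm@(refl , _) = All-at (signedPerm-nonzero perm)

apply-pos : ∀ π x → Pos x → apply π x ≡ at π ∣ x ∣
apply-pos π x pos with pos? x
... | yes _   = refl
... | no ¬pos = ⊥-elim (¬pos pos)

apply-nonpos : ∀ π x → ¬ Pos x → apply π x ≡ - at π ∣ x ∣
apply-nonpos π x ¬pos with pos? x
... | yes pos = ⊥-elim (¬pos pos)
... | no _    = refl

∣apply∣ : ∀ π x → ∣ apply π x ∣ ≡ ∣ at π ∣ x ∣ ∣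
∣apply∣ π x with pos? x
... | yes _ = refl
... | no _  = ℤ.∣-i∣≡∣i∣ (at π ∣ x ∣)

apply-neg : ∀ π w → 0 < ∣ w ∣ → apply π (- w) ≡ - apply π w
apply-neg π (+ suc n) _ = trans (apply-nonpos π -[1+ n ] λ ()) (cong -_ (sym (apply-pos π (+ suc n) (ℤ.+<+ ℕ.z<s))))
apply-neg π -[1+ n ] _ = begin
  apply π (+ suc n)       ≡⟨ apply-pos π (+ suc n) (ℤ.+<+ ℕ.z<s) ⟩
  at π (suc n)            ≡⟨ ℤ.neg-involutive (at π (suc n)) ⟨
  - - at π (suc n)        ≡⟨ cong -_ (apply-nonpos π -[1+ n ] λ ()) ⟨
  - apply π -[1+ n ]      ∎
  where open ≡-Reasoning

apply-negIf : ∀ π b w → 0 < ∣ w ∣ → apply π (negIf b w) ≡ negIf b (apply π w)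
apply-negIf π true  w w≢0 = apply-neg π w w≢0
apply-negIf π false _ _   = refl

∣at∣-involutive : ∀ {n π i} → IsSignedInvolution n π → 1 ≤ i → i ≤ n → ∣ at π ∣ at π i ∣ ∣ ≡ i
∣at∣-involutive {π = π} {i} inv 1≤i i≤n = begin
  ∣ at π ∣ at π i ∣ ∣          ≡⟨ cong (λ z → ∣ at π ∣ z ∣ ∣) (apply-pos π (+ i) (ℤ.+<+ 1≤i)) ⟨
  ∣ at π ∣ apply π (+ i) ∣ ∣   ≡⟨ ∣apply∣ π (apply π (+ i)) ⟨
  ∣ apply π (apply π (+ i)) ∣  ≡⟨ cong ∣_∣ (All.lookup inv (letters-complete (+ i) (1≤i , i≤n))) ⟩
  i                            ∎
  where open ≡-Reasoning

involution-diagonallySymmetric : ∀ {n π} → IsSignedPerm n π → IsSignedInvolution n π → DiagonallySymmetric π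
involution-diagonallySymmetric {π = π} (refl , _) inv {p} {v} pv∈ 0<v
  with 1≤p , p≤n , at≡ ← ∈-points⁻ pv∈ = ∈-points⁺ (begin
    at π v                   ≡⟨ apply-pos π (+ v) (ℤ.+<+ 0<v) ⟨
    apply π (+ v)            ≡⟨ cong (apply π) at≡ ⟨
    apply π (at π p)         ≡⟨ cong (apply π) (apply-pos π (+ p) (ℤ.+<+ 1≤p)) ⟨
    apply π (apply π (+ p))  ≡⟨ All.lookup inv (letters-complete (+ p) (1≤p , p≤n)) ⟩
    + p                      ∎) 1≤p
  where open ≡-Reasoning

-- The toggle involution

does-⇔ : ∀ {P Q : Set} → P ⇔ Q → (p? : Dec P) (q? : Dec Q) → does p? ≡ does q?
does-⇔ P⇔Q p? (yes q) = dec-true p? (Equivalence.from P⇔Q q)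
does-⇔ P⇔Q p? (no ¬q) = dec-false p? (¬q ∘ Equivalence.to P⇔Q)

module Toggle (m : ℕ) where

  HasRunAbove : ℕ → SWord → Set
  HasRunAbove t xs = ∃[ ws ] ws ⊆ xs × RunAbove m t ws

  -- Opaque so that `with hasRunAbove? …` can abstract the sign test inside toggle:
  -- unfolded, `does (map′ …)` reduces and the abstraction would miss it.
  opaque
    hasRunAbove? : ∀ t xs → Dec (HasRunAbove t xs)
    hasRunAbove? t xs = map′ from to (any? run? (subseqs m xs))
      where
      run? : ∀ ws → Dec (Decreasing ws × Above t ws)
      run? ws = (All.all? pos? ws ×-dec AllPairs.allPairs? (λ a b → ∣ b ∣ ℕ.<? ∣ a ∣) ws) ×-dec
                All.all? (λ w → t ℕ.<? ∣ w ∣) ws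
      from : Any (λ ws → Decreasing ws × Above t ws) (subseqs m xs) → HasRunAbove t xs
      from r with ws , ws∈ , run ← find r with ws⊆ , len ← subseqs⁻ m xs ws∈ = ws , ws⊆ , len , run
      to : HasRunAbove t xs → Any (λ ws → Decreasing ws × Above t ws) (subseqs m xs)
      to (ws , ws⊆ , refl , run) = lose (subseqs⁺ ws⊆) run

  hasRunAbove-≤ : ∀ {t t′ xs} → t ≤ t′ → HasRunAbove t′ xs → HasRunAbove t xs
  hasRunAbove-≤ t≤t′ (ws , ws⊆ , len , d , a) = ws , ws⊆ , len , d , All.map (ℕ.≤-<-trans t≤t′) a

  hasRunAbove-⊆ : ∀ {t xs ys} → xs ⊆ ys → HasRunAbove t xs → HasRunAbove t ys
  hasRunAbove-⊆ xs⊆ys (ws , ws⊆ , len , d , a) = ws , ⊆-trans ws⊆ xs⊆ys , len , d , a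

  hasRunAbove-∷ : ∀ {t x xs} → HasRunAbove t xs → HasRunAbove t (x ∷ xs)
  hasRunAbove-∷ = hasRunAbove-⊆ (_ ∷ʳ ⊆-refl)

  hasRunAbove-⊎ : ∀ {t ws xs} → RunAbove m t ws → ws ⊆ xs ⊎ HasRunAbove t xs → HasRunAbove t xs
  hasRunAbove-⊎ run = [ (λ ws⊆ → _ , ws⊆ , run) , id ]

  toggle : SWord → SWord
  toggle []       = []
  toggle (x ∷ xs) = negIf (does (hasRunAbove? ∣ x ∣ xs)) x ∷ toggle xs

  ⊆-toggle⁺ : ∀ {t ws} xs → ws ⊆ xs → Decreasing ws → Above t ws →
              ws ⊆ toggle xs ⊎ HasRunAbove t (toggle xs)
  ⊆-toggle⁺ []       []         _ _ = inj₁ []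
  ⊆-toggle⁺ (x ∷ xs) (_ ∷ʳ p)   d a = Sum.map (_ ∷ʳ_) hasRunAbove-∷ (⊆-toggle⁺ xs p d a)
  ⊆-toggle⁺ (x ∷ xs) (refl ∷ p) (_ ∷ pws , _ ∷ dws) (t<x ∷ aws) with hasRunAbove? ∣ x ∣ xs
  ... | yes (_ , vs⊆ , run@(_ , dvs , avs)) =
    inj₂ (hasRunAbove-∷ (hasRunAbove-≤ (ℕ.<⇒≤ t<x) (hasRunAbove-⊎ run (⊆-toggle⁺ xs vs⊆ dvs avs))))
  ... | no _ = Sum.map (refl ∷_) hasRunAbove-∷ (⊆-toggle⁺ xs p (pws , dws) aws)

  ⊆-toggle⁻ : ∀ {t ws} xs → ws ⊆ toggle xs → Decreasing ws → Above t ws →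
              ws ⊆ xs ⊎ HasRunAbove t xs
  ⊆-toggle⁻ []       []         _ _ = inj₁ []
  ⊆-toggle⁻ (x ∷ xs) (_ ∷ʳ p)   d a = Sum.map (_ ∷ʳ_) hasRunAbove-∷ (⊆-toggle⁻ xs p d a)
  ⊆-toggle⁻ (x ∷ xs) (refl ∷ p) (_ ∷ pws , _ ∷ dws) (t<x ∷ aws) with hasRunAbove? ∣ x ∣ xs
  ... | yes h = inj₂ (hasRunAbove-∷ (hasRunAbove-≤ (ℕ.<⇒≤ (subst (_ <_) (ℤ.∣-i∣≡∣i∣ x) t<x)) h))
  ... | no _  = Sum.map (refl ∷_) hasRunAbove-∷ (⊆-toggle⁻ xs p (pws , dws) aws)

  hasRunAbove-toggle : ∀ {t} xs → HasRunAbove t (toggle xs) ⇔ HasRunAbove t xs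
  hasRunAbove-toggle xs = mk⇔
    (λ (_ , ws⊆ , run@(_ , d , a)) → hasRunAbove-⊎ run (⊆-toggle⁻ xs ws⊆ d a))
    (λ (_ , ws⊆ , run@(_ , d , a)) → hasRunAbove-⊎ run (⊆-toggle⁺ xs ws⊆ d a))

  toggle-involutive : ∀ xs → toggle (toggle xs) ≡ xs
  toggle-involutive []       = refl
  toggle-involutive (x ∷ xs) = cong₂ _∷_ (begin
    negIf (does (hasRunAbove? ∣ negIf b x ∣ (toggle xs))) (negIf b x)
      ≡⟨ cong (λ c → negIf c (negIf b x)) same-flag ⟩
    negIf b (negIf b x)
      ≡⟨ negIf-involutive b x ⟩
    x ∎) (toggle-involutive xs)
    where
    open ≡-Reasoning
    b : Bool
    b = does (hasRunAbove? ∣ x ∣ xs)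
    same-flag : does (hasRunAbove? ∣ negIf b x ∣ (toggle xs)) ≡ b
    same-flag rewrite ∣negIf∣ b x =
      does-⇔ (hasRunAbove-toggle xs) (hasRunAbove? ∣ x ∣ (toggle xs)) (hasRunAbove? ∣ x ∣ xs)

  ∣toggle∣ : ∀ xs → map ∣_∣ (toggle xs) ≡ map ∣_∣ xs
  ∣toggle∣ []       = refl
  ∣toggle∣ (x ∷ xs) = cong₂ _∷_ (∣negIf∣ (does (hasRunAbove? ∣ x ∣ xs)) x) (∣toggle∣ xs)

  bar-++-⊆-toggle : ∀ {M σ ws α β} → σ ⊆ α → All (λ s → ∣ s ∣ ≤ M) σ → HasRunAbove M β →
                    ws ⊆ toggle β → bar σ ++ ws ⊆ toggle (α ++ β)
  bar-++-⊆-toggle []         _          _ ws⊆ = ws⊆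
  bar-++-⊆-toggle (_ ∷ʳ p)   σ≤M        h ws⊆ = _ ∷ʳ bar-++-⊆-toggle p σ≤M h ws⊆
  bar-++-⊆-toggle {α = x ∷ α} {β} (refl ∷ p) (x≤M ∷ σ≤M) h ws⊆ with hasRunAbove? ∣ x ∣ (α ++ β)
  ... | yes _ = refl ∷ bar-++-⊆-toggle p σ≤M h ws⊆
  ... | no ¬h = ⊥-elim (¬h (hasRunAbove-⊆ (Sublist.++⁺ˡ α ⊆-refl) (hasRunAbove-≤ x≤M h)))

  contains-toggle : ∀ {l π τ δ} → All (λ x → 0 < ∣ x ∣) π → All (InRange l) τ → RunAbove m l δ →
                    Contains π (τ ++ δ) → Contains (toggle π) (bar τ ++ δ)
  contains-toggle {l} {π} {τ} {δ} π≢0 τ-range (δ-len , δ-dec , δ-above) c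
    with σ , σ⊆π , iso ← contains⁻ c
    with σ₁ , σ₂ , refl , len₁ ← ++-length-split σ {τ} {δ} (proj₁ iso)
    with iso₁ , iso₂ , σ₁<σ₂ ← iso-++⁻ len₁ (≤-below (All.map proj₂ τ-range) δ-above) iso
    with α , β , refl , σ₁⊆α , σ₂⊆β ← ++-⊆-split σ₁ σ⊆π
    = conclude (hasRunAbove-⊎ σ₂-run (⊆-toggle⁺ β σ₂⊆β σ₂-dec σ₂-above))
    where
    M : ℕ
    M = max 0 (map ∣_∣ σ₁)
    σ₁≤M : All (λ s → ∣ s ∣ ≤ M) σ₁
    σ₁≤M = All.map⁻ (xs≤max 0 (map ∣_∣ σ₁))
    σ₁≢0 : All (λ s → 0 < ∣ s ∣) σ₁
    σ₁≢0 = Sublist.All-resp-⊆ σ₁⊆α (All.++⁻ˡ α π≢0)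
    σ₂-dec : Decreasing σ₂
    σ₂-dec = iso-decreasing iso₂ δ-dec
    σ₂-above : Above M σ₂
    σ₂-above = All.zipWith (λ (pos , σ₁<r) → max<v⁺ (pos⇒∣∣>0 pos) (All.map⁺ σ₁<r))
                           (proj₁ σ₂-dec , All-swap σ₁<σ₂)
    σ₂-run : RunAbove m M σ₂
    σ₂-run = trans (proj₁ iso₂) δ-len , σ₂-dec , σ₂-above
    conclude : HasRunAbove M (toggle β) → Contains (toggle (α ++ β)) (bar τ ++ δ)
    conclude (ws , ws⊆ , ws-len , ws-dec , ws-above) =
      contains⁺ (bar-++-⊆-toggle σ₁⊆α σ₁≤M (σ₂ , σ₂⊆β , σ₂-run) ws⊆)
        (iso-++⁺ (iso-bar σ₁≢0 (All.map proj₁ τ-range) iso₁)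
                 (decreasing-iso (trans ws-len (sym δ-len)) ws-dec δ-dec)
                 (≤-below (All-bar {P = _≤ M} σ₁≤M) ws-above)
                 (≤-below (All-bar {P = _≤ l} (All.map proj₂ τ-range)) δ-above))

  hasRunAbove-drop⁻ : ∀ {t} i π → HasRunAbove t (drop i π) → ∃[ D ] length D ≡ m × PointRun π i t D
  hasRunAbove-drop⁻ i π (ws , ws⊆ , len , (pos , dec) , above)
    with D , D⊆ , refl ← ⊆-map⁻ proj₂ (drop i (points π)) (subst (ws ⊆_) (drop-points i π) ws⊆) =
    D , trans (sym (List.length-map proj₂ D)) len ,
    All.zipWith (λ ((d∈ , i<d) , pos , above) → d∈ , i<d , pos , above)
      (All.map (∈-drop-points⁻ i π) (All.tabulate (lookup D⊆)) , All.zip (All.map⁻ pos , All.map⁻ above)) ,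
    AllPairs.zip (AllPairs-resp-⊆ D⊆ (AllPairs.drop⁺ i (points-sorted π)) , AllPairs.map⁻ dec)

  hasRunAbove-drop⁺ : ∀ {t} i π {D} → length D ≡ m → PointRun π i t D → HasRunAbove t (drop i π)
  hasRunAbove-drop⁺ i π {D} len (ps , sorted) =
    map proj₂ D ,
    subst (map proj₂ D ⊆_) (sym (drop-points i π)) (Sublist.map⁺ proj₂ D⊆) ,
    trans (List.length-map proj₂ D) len ,
    (All.map⁺ (All.map (proj₁ ∘ proj₂ ∘ proj₂) ps) , AllPairs.map⁺ (AllPairs.map proj₂ sorted)) ,
    All.map⁺ (All.map (proj₂ ∘ proj₂ ∘ proj₂) ps)
    where
    D⊆ : D ⊆ drop i (points π)
    D⊆ = sorted-⊆ (λ { refl → ℕ.<-irrefl refl }) ℕ.<-trans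
           (AllPairs.drop⁺ i (points-sorted π)) (AllPairs.map proj₁ sorted)
           (All.map (λ (d∈ , i<d , _) → ∈-drop-points⁺ i π d∈ i<d) ps)

  hasRunAbove-transpose : ∀ {π i t} → DiagonallySymmetric π → HasRunAbove t (drop i π) → HasRunAbove i (drop t π)
  hasRunAbove-transpose {π} {i} {t} sym-π h with D , len , run ← hasRunAbove-drop⁻ i π h =
    hasRunAbove-drop⁺ t π (trans (List.length-reverse (map transpose D)) (trans (List.length-map transpose D) len))
      (pointRun-transpose sym-π run)

  toggles : SWord → ℕ → Bool
  toggles π i = does (hasRunAbove? ∣ at π i ∣ (drop i π))

  at-toggle : ∀ π i → at (toggle π) i ≡ negIf (toggles π i) (at π i)
  at-toggle []       i             = sym (negIf-0 (toggles [] i))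
  at-toggle (x ∷ xs) zero          = sym (negIf-0 (toggles (x ∷ xs) zero))
  at-toggle (x ∷ xs) (suc zero)    = refl
  at-toggle (x ∷ xs) (suc (suc i)) = at-toggle xs (suc i)

  apply-toggle : ∀ π x → apply (toggle π) x ≡ negIf (toggles π ∣ x ∣) (apply π x)
  apply-toggle π x with pos? x
  ... | yes _ = at-toggle π ∣ x ∣
  ... | no _  = trans (cong -_ (at-toggle π ∣ x ∣)) (neg-negIf (toggles π ∣ x ∣) (at π ∣ x ∣))

  toggles-∣at∣ : ∀ {n π i} → IsSignedPerm n π → IsSignedInvolution n π → 1 ≤ i → i ≤ n →
                   toggles π ∣ at π i ∣ ≡ toggles π i
  toggles-∣at∣ {π = π} {i} perm inv 1≤i i≤n = begin
    does (hasRunAbove? ∣ at π j ∣ (drop j π))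
      ≡⟨ cong (λ t → does (hasRunAbove? t (drop j π))) (∣at∣-involutive inv 1≤i i≤n) ⟩
    does (hasRunAbove? i (drop j π))
      ≡⟨ does-⇔ (mk⇔ (hasRunAbove-transpose sym-π) (hasRunAbove-transpose sym-π))
                (hasRunAbove? i (drop j π)) (hasRunAbove? j (drop i π)) ⟩
    does (hasRunAbove? j (drop i π)) ∎
    where
    open ≡-Reasoning
    j : ℕ
    j = ∣ at π i ∣
    sym-π : DiagonallySymmetric π
    sym-π = involution-diagonallySymmetric perm inv

  toggle-involution : ∀ {n π} → IsSignedPerm n π → IsSignedInvolution n π → IsSignedInvolution n (toggle π)
  toggle-involution {n} {π} perm inv = All.tabulate involutive
    where
    involutive : ∀ {x} → x ∈ letters n → apply (toggle π) (apply (toggle π) x) ≡ x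
    involutive {x} x∈ = begin
      apply (toggle π) (apply (toggle π) x)               ≡⟨ cong (apply (toggle π)) (apply-toggle π x) ⟩
      apply (toggle π) (negIf b z)                        ≡⟨ apply-toggle π (negIf b z) ⟩
      negIf (toggles π ∣ negIf b z ∣) (apply π (negIf b z))  ≡⟨ cong₂ negIf same-flag (apply-negIf π b z z≢0) ⟩
      negIf b (negIf b (apply π z))                       ≡⟨ negIf-involutive b (apply π z) ⟩
      apply π z                                           ≡⟨ All.lookup inv x∈ ⟩
      x                                                   ∎
      where
      open ≡-Reasoning
      b : Bool
      b = toggles π ∣ x ∣
      z : ℤ
      z = apply π x
      x-range : InRange n x
      x-range = letters-sound x∈
      z≢0 : 0 < ∣ z ∣
      z≢0 = subst (0 <_) (sym (∣apply∣ π x)) (at-nonzero perm (proj₁ x-range) (proj₂ x-range))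
      same-flag : toggles π ∣ negIf b z ∣ ≡ b
      same-flag = trans (cong (toggles π) (trans (∣negIf∣ b z) (∣apply∣ π x)))
                        (toggles-∣at∣ perm inv (proj₁ x-range) (proj₂ x-range))

  length-toggle : ∀ xs → length (toggle xs) ≡ length xs
  length-toggle []       = refl
  length-toggle (x ∷ xs) = cong suc (length-toggle xs)

  All-toggle : ∀ {P : ℕ → Set} {π} → All (P ∘ ∣_∣) π → All (P ∘ ∣_∣) (toggle π)
  All-toggle {P = P} {π} ps = All.map⁻ (subst (All P) (sym (∣toggle∣ π)) (All.map⁺ ps))

  toggle-signedPerm : ∀ {n π} → IsSignedPerm n π → IsSignedPerm n (toggle π)
  toggle-signedPerm {n} {π} (len , π-range , uniq) =
    trans (length-toggle π) len ,
    All-toggle {P = λ a → 1 ≤ a × a ≤ n} π-range ,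
    subst Unique (sym (∣toggle∣ π)) uniq

  toggle-∈Bn : ∀ n {π} → π ∈ Bn n → toggle π ∈ Bn n
  toggle-∈Bn n = ∈-Bn⁺ ∘ toggle-signedPerm ∘ ∈-Bn⁻ n

  toggle-∈SIn : ∀ n {π} → π ∈ SIn n → toggle π ∈ SIn n
  toggle-∈SIn n π∈ with perm , inv ← ∈-SIn⁻ n π∈ =
    ∈-filter⁺ (isSignedInvolution? n) (∈-Bn⁺ (toggle-signedPerm perm)) (toggle-involution perm inv)

  avoids-toggle : ∀ {l π τ δ} → All (λ x → 0 < ∣ x ∣) π → All (InRange l) τ → RunAbove m l δ →
                  Avoids π (bar τ ++ δ) → Avoids (toggle π) (τ ++ δ)
  avoids-toggle {π = π} π≢0 τ-range δ-run avoids c =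
    avoids (subst (λ σ → Contains σ _) (toggle-involutive π)
             (contains-toggle (All-toggle {P = 0 <_} π≢0) τ-range δ-run c))

  avoiding-toggle : ∀ {l τ δ} (S : List SWord) → Unique S → (∀ {π} → π ∈ S → toggle π ∈ S) →
                    (∀ {π} → π ∈ S → All (λ x → 0 < ∣ x ∣) π) →
                    All (InRange l) τ → RunAbove m l δ →
                    length (avoiding (τ ++ δ) S) ≡ length (avoiding (bar τ ++ δ) S)
  avoiding-toggle {l} {τ} {δ} S S-unique S-closed S≢0 τ-range δ-run =
    involution⇒length-≡ toggle toggle-involutive
      (Unique.filter⁺ (avoids? (τ ++ δ)) S-unique) (Unique.filter⁺ (avoids? (bar τ ++ δ)) S-unique)
      (move (λ π∈ → avoids-toggle (S≢0 π∈) (All-bar {P = λ a → 1 ≤ a × a ≤ l} τ-range) δ-run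
                      ∘ subst (λ ρ → Avoids _ (ρ ++ δ)) (sym (bar-involutive τ))))
      (move (λ π∈ → avoids-toggle (S≢0 π∈) τ-range δ-run))
    where
    move : ∀ {ρ ρ′} → (∀ {π} → π ∈ S → Avoids π ρ → Avoids (toggle π) ρ′) →
           ∀ {π} → π ∈ avoiding ρ S → toggle π ∈ avoiding ρ′ S
    move {ρ} {ρ′} f π∈ with π∈S , avoids ← ∈-filter⁻ (avoids? ρ) {xs = S} π∈ =
      ∈-filter⁺ (avoids? ρ′) (S-closed π∈S) (f π∈S avoids)

theorem2p3 : (l k : ℕ) → l ≤ k → (τ : SWord) → IsSignedPerm l τ →
    (n : ℕ) → 1 ≤ n →
      length (avoiding (τ ++ decTail l k) (Bn n))
        ≡ length (avoiding (bar τ ++ decTail l k) (Bn n))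
      × length (avoiding (τ ++ decTail l k) (SIn n))
        ≡ length (avoiding (bar τ ++ decTail l k) (SIn n))
theorem2p3 l k _ τ (_ , τ-range , _) n _ =
  avoiding-toggle (Bn n) (Bn-unique n) (toggle-∈Bn n) (signedPerm-nonzero ∘ ∈-Bn⁻ n) τ-range tail ,
  avoiding-toggle (SIn n) (SIn-unique n) (toggle-∈SIn n) (signedPerm-nonzero ∘ proj₁ ∘ ∈-SIn⁻ n) τ-range tail
  where
  open Toggle (k ∸ l)
  tail : RunAbove (k ∸ l) l (decTail l k)
  tail = decTail-runAbove l k
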